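{- Let $G=(V,E)$ be a strongly connected directed graph and $v\in V$. Let $D(v)$ be the dominator tree of the flow graph $G(v)$, and call a vertex $x\neq v$ marked if the edge $(d(x),x)$ is a bridge of $G(v)$. For a vertex $w\neq v$, there are two edge-disjoint paths from $v$ to $w$ in $G$ if and only if $w$ is not dominated in $G(v)$ by any marked vertex.
   Context: The flow graph $G(v)$ is $G$ with designated start vertex $v$. A vertex $u$ dominates $x$ in $G(v)$ if every path from $v$ to $x$ contains $u$ (dominance is reflexive, so every vertex dominates itself). The dominator tree $D(v)$ is the rooted tree on $V$ with root $v$ in which $u$ is an ancestor of $x$ iff $u$ dominates $x$; $d(x)$ denotes the parent of $x\neq v$ in $D(v)$ (its immediate dominator). An edge $(u,x)$ is a bridge of $G(v)$ if every path from $v$ to $x$ contains $(u,x)$; in that case $u=d(x)$. -}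

module Defs where

open import Data.Nat using (ℕ)
open import Data.Fin using (Fin)
open import Data.Bool using (Bool; true)
open import Data.Product using (Σ; _×_; ∃; ∃-syntax)
open import Relation.Binary.PropositionalEquality using (_≡_; _≢_)
open import Relation.Nullary using (¬_)

Digraph : ℕ → Set
Digraph n = Fin n → Fin n → Bool

module _ {n : ℕ} (E : Digraph n) where

  Edge : Fin n → Fin n → Set
  Edge a b = E a b ≡ true

  -- Directed paths (walks) from x to z in G.
  data Path : Fin n → Fin n → Set where
    [_]  : (x : Fin n) → Path x x
    _∷_  : ∀ {x y z} → Edge x y → Path y z → Path x z

  data VertexOn (u : Fin n) : ∀ {x z} → Path x z → Set where
    here-end : VertexOn u [ u ]
    here     : ∀ {z y} (e : Edge u y) (p : Path y z) → VertexOn u (e ∷ p)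
    there    : ∀ {x y z} (e : Edge x y) {p : Path y z} →
               VertexOn u p → VertexOn u (e ∷ p)

  data EdgeOn (a b : Fin n) : ∀ {x z} → Path x z → Set where
    here  : ∀ {z} (e : Edge a b) (p : Path b z) → EdgeOn a b (e ∷ p)
    there : ∀ {x y z} (e : Edge x y) {p : Path y z} →
            EdgeOn a b p → EdgeOn a b (e ∷ p)

  StronglyConnected : Set
  StronglyConnected = ∀ x y → Path x y

  Dominates : (v u x : Fin n) → Set
  Dominates v u x = (p : Path v x) → VertexOn u p

  -- u is the immediate dominator d(x) of x in G(v), i.e. the parent of x
  -- in the dominator tree D(v): a proper dominator of x dominated by every
  -- proper dominator of x.
  IDom : (v u x : Fin n) → Set
  IDom v u x = u ≢ x × Dominates v u x ×
               (∀ w → w ≢ x → Dominates v w x → Dominates v w u)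

  Bridge : (v u x : Fin n) → Set
  Bridge v u x = Edge u x × ((p : Path v x) → EdgeOn u x p)

  Marked : (v x : Fin n) → Set
  Marked v x = x ≢ v × ∃[ u ] (IDom v u x × Bridge v u x)

  TwoEdgeDisjointPaths : (v w : Fin n) → Set
  TwoEdgeDisjointPaths v w =
    Σ (Path v w) λ p → Σ (Path v w) λ q →
      ∀ a b → EdgeOn a b p → ¬ EdgeOn a b q

module Submission where

-- Both sides are compared with a third condition: no edge is unavoidable,
-- i.e. lies on every walk from v to w.
--  * A marked vertex x dominating w makes its bridge (d(x) , x) unavoidable,
--    and two edge-disjoint paths cannot share an unavoidable edge.
--  * Conversely, the head b of an unavoidable edge (a , b) is marked with
--    d(b) = a and dominates w.
--  * Menger's theorem for two paths: given a simple path P from v to w, either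
--    the residual graph of P contains an augmenting walk, along which P is
--    rerouted into two edge-disjoint paths, or the set S of vertices that are
--    residually reachable from v is left by exactly one edge of P, and every
--    walk from v to w has to use that edge.  Strong connectivity is used only to obtain the path P.

open import Defs
open import Data.Nat using (ℕ; zero; suc; _≤_; _≤?_; z≤n; s≤s)
open import Data.Nat.Properties using (≰⇒>)
open import Data.Fin using (Fin; _≟_) renaming (_<_ to _<ᶠ_)
open import Data.Fin.Properties using (any?; pigeonhole)
open import Data.Bool using (true)
open import Data.Bool.Properties using (T-≡) renaming (_≟_ to _≟ᵇ_)
open import Data.Product using (Σ; ∃₂; _×_; _,_; proj₁; proj₂; ∃-syntax)
open import Data.Product.Properties using (≡-dec)
open import Data.Sum using (_⊎_; inj₁; inj₂)
open import Data.Empty using (⊥-elim)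
open import Data.List using (List; []; _∷_; _++_; length; lookup)
open import Data.List.Properties using (++-identityʳ)
open import Data.List.Membership.Propositional using (_∈_; _∉_)
open import Data.List.Membership.Propositional.Properties using (∈-++⁺ˡ; ∈-++⁺ʳ; ∈-++⁻; ∈-lookup)
import Data.List.Membership.DecPropositional as DecMembership
open import Data.List.Relation.Unary.Any using (here; there)
open import Data.List.Relation.Unary.All.Properties using (All¬⇒¬Any; ¬Any⇒All¬)
open import Data.List.Relation.Unary.AllPairs using ([]; _∷_)
open import Data.List.Relation.Unary.Unique.Propositional using (Unique)
open import Data.List.Relation.Unary.Unique.Propositional.Properties using (Unique[x∷xs]⇒x∉xs)
open import Data.List.Relation.Binary.Subset.Propositional using (_⊆_)
open import Data.List.Relation.Binary.Permutation.Propositional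
  using (_↭_; ↭-refl; ↭-sym; ↭⇒↭ₛ; module PermutationReasoning)
open import Data.List.Relation.Binary.Permutation.Propositional.Properties
  using (∈-resp-↭; ++⁺ˡ; shifts; ++-commutativeMonoid)
import Data.List.Relation.Binary.Permutation.Setoid.Properties as PermutationSetoid
import Algebra.Solver.CommutativeMonoid as CommutativeMonoidSolver
open import Relation.Binary.Definitions using (DecidableEquality)
open import Relation.Binary.PropositionalEquality using (_≡_; _≢_; refl; sym; cong; subst; setoid)
open import Relation.Nullary using (¬_; Dec; yes; no; ¬?)
open import Relation.Nullary.Decidable using (⌊_⌋; _×-dec_; _⊎-dec_; toWitness; fromWitness)
open import Relation.Unary using (Decidable)
open import Function.Bundles using (_⇔_; mk⇔; Equivalence)

private variable
  A : Set
  t : A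
  xs ys : List A

unique-resp-↭ : {A : Set} {xs ys : List A} → xs ↭ ys → Unique xs → Unique ys
unique-resp-↭ {A = A} p = PermutationSetoid.Unique-resp-↭ (setoid A) (↭⇒↭ₛ p)

unique-∷ : t ∉ xs → Unique xs → Unique (t ∷ xs)
unique-∷ {xs = xs} x∉xs u = ¬Any⇒All¬ xs x∉xs ∷ u

unique-++-disjoint : ∀ xs → Unique (xs ++ ys) → t ∈ xs → t ∉ ys
unique-++-disjoint (_ ∷ xs) (x∉ ∷ _) (here refl) m = All¬⇒¬Any x∉ (∈-++⁺ʳ xs m)
unique-++-disjoint (_ ∷ xs) (_ ∷ u) (there k) m = unique-++-disjoint xs u k m

unique-lookup : Unique xs → ∀ {i j} → i <ᶠ j → lookup xs i ≢ lookup xs j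
unique-lookup {xs = _ ∷ xs} (x∉ ∷ _) {Fin.zero} {Fin.suc j} _ eq =
  All¬⇒¬Any x∉ (subst (_∈ xs) (sym eq) (∈-lookup j))
unique-lookup (_ ∷ u) {Fin.suc i} {Fin.suc j} (s≤s i<j) = unique-lookup u i<j

unique-length : ∀ {n} (xs : List (Fin n)) → Unique xs → length xs ≤ n
unique-length {n} xs u with length xs ≤? n
... | yes short = short
... | no long with pigeonhole (≰⇒> long) (lookup xs)
...   | i , j , i<j , eq = ⊥-elim (unique-lookup u i<j eq)

_≟ₑ_ : ∀ {n} → DecidableEquality (Fin n × Fin n)
_≟ₑ_ = ≡-dec _≟_ _≟_

_∈ₑ?_ : ∀ {n} (e : Fin n × Fin n) es → Dec (e ∈ es)
e ∈ₑ? es = DecMembership._∈?_ _≟ₑ_ e es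

_∈ᵥ?_ : ∀ {n} (x : Fin n) xs → Dec (x ∈ xs)
x ∈ᵥ? xs = DecMembership._∈?_ _≟_ x xs

module Rearrange {A : Set} = CommutativeMonoidSolver (++-commutativeMonoid {A = A})

-- Walks in a digraph F
module Walks {n : ℕ} (F : Digraph n) where

  private variable
    a b u x y z : Fin n

  infixr 5 _++ₚ_

  _++ₚ_ : Path F x y → Path F y z → Path F x z
  [ _ ] ++ₚ q = q
  (e ∷ p) ++ₚ q = e ∷ (p ++ₚ q)

  edges : Path F x z → List (Fin n × Fin n)
  edges [ _ ] = []
  edges (_∷_ {x} {y} _ p) = (x , y) ∷ edges p

  sources : Path F x z → List (Fin n)
  sources [ _ ] = []
  sources (_∷_ {x} _ p) = x ∷ sources p

  edges-++ : (p : Path F x y) (q : Path F y z) → edges (p ++ₚ q) ≡ edges p ++ edges q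
  edges-++ [ _ ] q = refl
  edges-++ (e ∷ p) q = cong (_ ∷_) (edges-++ p q)

  Unavoidable : (x z a b : Fin n) → Set
  Unavoidable x z a b = (p : Path F x z) → (a , b) ∈ edges p

  edgeOn⇒∈ : {p : Path F x z} → EdgeOn F a b p → (a , b) ∈ edges p
  edgeOn⇒∈ (here e p) = here refl
  edgeOn⇒∈ (there e m) = there (edgeOn⇒∈ m)

  ∈⇒edgeOn : (p : Path F x z) → (a , b) ∈ edges p → EdgeOn F a b p
  ∈⇒edgeOn (e ∷ p) (here refl) = here e p
  ∈⇒edgeOn (e ∷ p) (there m) = there e (∈⇒edgeOn p m)

  ∈⇒edge : (p : Path F x z) → (a , b) ∈ edges p → Edge F a b
  ∈⇒edge (e ∷ p) (here refl) = e
  ∈⇒edge (e ∷ p) (there m) = ∈⇒edge p m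

  startOn : (p : Path F x z) → VertexOn F x p
  startOn [ x ] = here-end
  startOn (e ∷ p) = here e p

  ∈⇒sourceOn : (p : Path F x z) → (a , b) ∈ edges p → VertexOn F a p
  ∈⇒sourceOn (e ∷ p) (here refl) = here e p
  ∈⇒sourceOn (e ∷ p) (there m) = there e (∈⇒sourceOn p m)

  ∈⇒targetOn : (p : Path F x z) → (a , b) ∈ edges p → VertexOn F b p
  ∈⇒targetOn (e ∷ p) (here refl) = there e (startOn p)
  ∈⇒targetOn (e ∷ p) (there m) = there e (∈⇒targetOn p m)

  prefixTo : {p : Path F x z} → VertexOn F u p → Σ (Path F x u) λ p₁ → edges p₁ ⊆ edges p
  prefixTo here-end = [ _ ] , λ ()
  prefixTo (here e p) = [ _ ] , λ ()
  prefixTo (there e m) with prefixTo m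
  ... | p₁ , p₁⊆p = e ∷ p₁ , λ { (here eq) → here eq ; (there k) → there (p₁⊆p k) }

  vertexOn-snoc : (p : Path F x a) (e : Edge F a b) →
                  VertexOn F u (p ++ₚ (e ∷ [ b ])) → VertexOn F u p ⊎ u ≡ b
  vertexOn-snoc [ _ ] e (here _ _) = inj₁ here-end
  vertexOn-snoc [ _ ] e (there _ here-end) = inj₂ refl
  vertexOn-snoc (e′ ∷ p) e (here _ _) = inj₁ (here e′ p)
  vertexOn-snoc (e′ ∷ p) e (there _ m) with vertexOn-snoc p e m
  ... | inj₁ on = inj₁ (there e′ on)
  ... | inj₂ u≡b = inj₂ u≡b

  record Split (p : Path F x z) (a b : Fin n) : Set where
    constructor split
    field
      before : Path F x a
      after : Path F b z
      edges-split : edges p ≡ edges before ++ (a , b) ∷ edges after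

  splitAt : (p : Path F x z) → (a , b) ∈ edges p → Split p a b
  splitAt (e ∷ p) (here refl) = split [ _ ] p refl
  splitAt (e ∷ p) (there m) with splitAt p m
  ... | split p₁ p₂ eq = split (e ∷ p₁) p₂ (cong (_ ∷_) eq)

  beforeFirst : (p : Path F x z) → (a , b) ∈ edges p → Σ (Path F x a) λ p₁ → (a , b) ∉ edges p₁
  beforeFirst (e ∷ p) (here refl) = [ _ ] , λ ()
  beforeFirst {x} {a = a} {b} (_∷_ {y = y} e p) (there m) with (x , y) ≟ₑ (a , b)
  ... | yes refl = [ _ ] , λ ()
  ... | no ne with beforeFirst p m
  ...   | p₁ , ∉p₁ = e ∷ p₁ , λ { (here eq) → ne (sym eq) ; (there k) → ∉p₁ k }

  afterLast : (p : Path F x z) → (a , b) ∈ edges p → Σ (Path F b z) λ p₂ → (a , b) ∉ edges p₂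
  afterLast {a = a} {b} (e ∷ p) m with (a , b) ∈ₑ? edges p
  ... | yes m′ = afterLast p m′
  afterLast (e ∷ p) (here refl) | no ∉p = p , ∉p
  afterLast (e ∷ p) (there m) | no ∉p = ⊥-elim (∉p m)

  ∈edges⇒∈sources : (p : Path F x z) → (a , b) ∈ edges p → a ∈ sources p
  ∈edges⇒∈sources (e ∷ p) (here refl) = here refl
  ∈edges⇒∈sources (e ∷ p) (there m) = there (∈edges⇒∈sources p m)

  simple⇒edges-unique : (p : Path F x z) → Unique (sources p) → Unique (edges p)
  simple⇒edges-unique [ _ ] _ = []
  simple⇒edges-unique (e ∷ p) u@(_ ∷ u′) =
    unique-∷ (λ m → Unique[x∷xs]⇒x∉xs u (∈edges⇒∈sources p m)) (simple⇒edges-unique p u′)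

  suffixFrom : (q : Path F y z) → x ∈ sources q →
               Σ (Path F x z) λ r → (Unique (sources q) → Unique (sources r))
  suffixFrom (e ∷ q) (here refl) = e ∷ q , λ u → u
  suffixFrom (e ∷ q) (there m) with suffixFrom q m
  ... | r , keep = r , λ { (_ ∷ u) → keep u }

  simplify : Path F x z → Σ (Path F x z) λ q → Unique (sources q)
  simplify [ x ] = [ x ] , []
  simplify {x} (e ∷ p) with simplify p
  ... | q , simple with x ∈ᵥ? sources q
  ...   | yes m = proj₁ (suffixFrom q m) , proj₂ (suffixFrom q m) simple
  ...   | no x∉ = e ∷ q , unique-∷ x∉ simple

  edge? : ∀ x y → Dec (Edge F x y)
  edge? x y = F x y ≟ᵇ true

  reachableWithin? : ∀ k x z → Dec (Σ (Path F x z) λ p → length (sources p) ≤ k)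
  reachableWithin? k x z with x ≟ z
  ... | yes refl = yes ([ x ] , z≤n)
  reachableWithin? zero x z | no x≢z = no λ { ([ _ ] , _) → x≢z refl ; (_ ∷ _ , ()) }
  reachableWithin? (suc k) x z | no x≢z with any? (λ y → edge? x y ×-dec reachableWithin? k y z)
  ... | yes (y , e , p , len) = yes (e ∷ p , s≤s len)
  ... | no none = no λ { ([ _ ] , _) → x≢z refl ; (e ∷ p , s≤s len) → none (_ , e , p , len) }

  -- Reachability is decidable, since a simple walk departs from at most n vertices.
  reachable? : ∀ x z → Dec (Path F x z)
  reachable? x z with reachableWithin? n x z
  ... | yes (p , _) = yes p
  ... | no none = no λ p → let q , simple = simplify p in none (q , unique-length (sources q) simple)

  module Crossing {S : Fin n → Set} (S? : Decidable S) where

    Leaving Entering : Fin n × Fin n → Set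
    Leaving e = S (proj₁ e) × ¬ S (proj₂ e)
    Entering e = ¬ S (proj₁ e) × S (proj₂ e)

    leavingEdge : (p : Path F x z) → S x → ¬ S z → ∃[ e ] (e ∈ edges p × Leaving e)
    leavingEdge [ _ ] s ¬s = ⊥-elim (¬s s)
    leavingEdge (_∷_ {x} {y} _ p) s ¬s with S? y
    ... | no ¬sy = (x , y) , here refl , s , ¬sy
    ... | yes sy with leavingEdge p sy ¬s
    ...   | e , m , leaving = e , there m , leaving

    enteringEdge : (p : Path F x z) → ¬ S x → S z → ∃[ e ] (e ∈ edges p × Entering e)
    enteringEdge [ _ ] ¬s s = ⊥-elim (¬s s)
    enteringEdge (_∷_ {x} {y} _ p) ¬s s with S? y
    ... | yes sy = (x , y) , here refl , ¬s , sy
    ... | no ¬sy with enteringEdge p ¬sy s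
    ...   | e , m , entering = e , there m , entering

    reenters : (p : Path F x z) → ¬ S x → (a , b) ∈ edges p → S a →
               ∃[ e ] (e ∈ edges p × Entering e)
    reenters p ¬sx m sa with prefixTo (∈⇒sourceOn p m)
    ... | p₁ , p₁⊆p with enteringEdge p₁ ¬sx sa
    ...   | e , m₁ , entering = e , p₁⊆p m₁ , entering

    leaving-unique : (p : Path F x z) → (∀ {e} → e ∈ edges p → ¬ Entering e) →
                     ∀ {e e′} → e ∈ edges p → Leaving e → e′ ∈ edges p → Leaving e′ → e ≡ e′
    leaving-unique (_ ∷ p) noEntry (here refl) _ (here refl) _ = refl
    leaving-unique (_ ∷ p) noEntry (here refl) (_ , ¬sb) (there m′) (sa′ , _)
      with reenters p ¬sb m′ sa′
    ... | _ , k , entering = ⊥-elim (noEntry (there k) entering)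
    leaving-unique (_ ∷ p) noEntry (there m) (sa , _) (here refl) (_ , ¬sb′)
      with reenters p ¬sb′ m sa
    ... | _ , k , entering = ⊥-elim (noEntry (there k) entering)
    leaving-unique (_ ∷ p) noEntry (there m) leaving (there m′) leaving′ =
      leaving-unique p (λ k → noEntry (there k)) m leaving m′ leaving′

-- Unavoidable edges and marked vertices in the flow graph G(v)
module Unavoidability {n : ℕ} (E : Digraph n) {v : Fin n} where
  open Walks E

  private variable
    a b w : Fin n

  disjoint⇒avoidable : TwoEdgeDisjointPaths E v w → ¬ Unavoidable v w a b
  disjoint⇒avoidable (p , q , disjoint) H =
    disjoint _ _ (∈⇒edgeOn p (H p)) (∈⇒edgeOn q (H q))

  -- A marked vertex x dominating w makes its bridge (d(x) , x) unavoidable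
  -- from v to w: every walk to w passes x, and its part up to x uses the bridge.
  marked⇒unavoidable : ∀ {x} → Marked E v x → Dominates E v x w → ∃[ u ] Unavoidable v w u x
  marked⇒unavoidable (_ , u , _ , _ , bridge) dom = u , λ p →
    let p₁ , p₁⊆p = prefixTo (dom p) in p₁⊆p (edgeOn⇒∈ (bridge p₁))

  -- An edge (a , b) unavoidable from v to w is unavoidable from v to b: a walk
  -- to b continues to w along the part of P after its last use of (a , b).
  unavoidable-to-head : Path E v w → Unavoidable v w a b → Unavoidable v b a b
  unavoidable-to-head {a = a} {b} P H q with afterLast P (H P)
  ... | r , ∉r with ∈-++⁻ (edges q) (subst ((a , b) ∈_) (edges-++ q r) (H (q ++ₚ r)))
  ...   | inj₁ inq = inq
  ...   | inj₂ inr = ⊥-elim (∉r inr)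

  -- The head b of an unavoidable edge (a , b) is marked, with d(b) = a, and
  -- dominates w.  Every proper dominator u of b dominates a, as u lies on
  -- each walk to a extended by the edge (a , b).
  unavoidable⇒marked : Edge E a b → Path E v w → Unavoidable v w a b →
                       Marked E v b × Dominates E v b w
  unavoidable⇒marked {a} {b} e P H =
    (b≢v , a , (a≢b , a-dom-b , a-idom) , e , λ p → ∈⇒edgeOn p (Hb p)) ,
    (λ p → ∈⇒targetOn p (H p))
    where
    Hb : Unavoidable v b a b
    Hb = unavoidable-to-head P H

    b≢v : b ≢ v
    b≢v refl with Hb [ _ ]
    ... | ()

    a≢b : a ≢ b
    a≢b refl = let p₁ , ∉p₁ = beforeFirst P (H P) in ∉p₁ (Hb p₁)

    a-dom-b : Dominates E v a b
    a-dom-b p = ∈⇒sourceOn p (Hb p)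

    a-idom : ∀ u → u ≢ b → Dominates E v u b → Dominates E v u a
    a-idom u u≢b dom p with vertexOn-snoc p e (dom (p ++ₚ (e ∷ [ b ])))
    ... | inj₁ on = on
    ... | inj₂ u≡b = ⊥-elim (u≢b u≡b)

-- Stages of rerouting a path from v to w along an augmenting walk: a walk
-- from v to w, a walk from v to the current front y, and a list of closed
-- walks; `used` collects their edges with multiplicity.
module Configurations {n : ℕ} (E : Digraph n) (v w : Fin n) where
  open Walks E
  open PermutationReasoning
  open Rearrange {Fin n × Fin n} using (solve; _⊕_; _⊜_)

  private variable
    y z : Fin n

  Cycle : Set
  Cycle = Σ (Fin n) λ c → Path E c c

  cycleEdges : List Cycle → List (Fin n × Fin n)
  cycleEdges [] = []
  cycleEdges ((_ , C) ∷ Cs) = edges C ++ cycleEdges Cs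

  extractCycle : ∀ Cs {e} → e ∈ cycleEdges Cs →
                 Σ Cycle λ C → Σ (List Cycle) λ Cs′ →
                   e ∈ edges (proj₂ C) × cycleEdges Cs ↭ edges (proj₂ C) ++ cycleEdges Cs′
  extractCycle ((c , C) ∷ Cs) m with ∈-++⁻ (edges C) m
  ... | inj₁ inC = (c , C) , Cs , inC , ↭-refl
  ... | inj₂ inCs with extractCycle Cs inCs
  ...   | (c′ , C′) , Cs′ , inC′ , perm = (c′ , C′) , (c , C) ∷ Cs′ , inC′ , (begin
    edges C ++ cycleEdges Cs                 ↭⟨ ++⁺ˡ (edges C) perm ⟩
    edges C ++ edges C′ ++ cycleEdges Cs′    ↭⟨ shifts (edges C) (edges C′) ⟩
    edges C′ ++ edges C ++ cycleEdges Cs′    ∎)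

  record Config (y : Fin n) : Set where
    constructor config
    field
      toTarget : Path E v w
      toFront : Path E v y
      cycles : List Cycle

  used : Config y → List (Fin n × Fin n)
  used (config A B Cs) = edges A ++ edges B ++ cycleEdges Cs

  advance : (c : Config y) → Edge E y z → Σ (Config z) λ c′ → used c′ ↭ (y , z) ∷ used c
  advance {y} {z} (config A B Cs) e = config A (B ++ₚ (e ∷ [ z ])) Cs , (begin
    edges A ++ edges (B ++ₚ (e ∷ [ z ])) ++ cycleEdges Cs
      ≡⟨ cong (λ t → edges A ++ t ++ cycleEdges Cs) (edges-++ B (e ∷ [ z ])) ⟩
    edges A ++ (edges B ++ (y , z) ∷ []) ++ cycleEdges Cs
      ↭⟨ solve 4 (λ a b c yz → a ⊕ ((b ⊕ yz) ⊕ c) ⊜ yz ⊕ (a ⊕ (b ⊕ c))) ↭-refl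
           (edges A) (edges B) (cycleEdges Cs) ((y , z) ∷ []) ⟩
    (y , z) ∷ edges A ++ edges B ++ cycleEdges Cs ∎)

  Retreat : Config y → Fin n → Set
  Retreat {y} c z = Σ (Config z) λ c′ → used c ↭ (z , y) ∷ used c′

  -- The edge lies on the walk to w: the two walks exchange their tails.
  swapTails : (A : Path E v w) (B : Path E v y) (Cs : List Cycle) →
              Split A z y → Retreat (config A B Cs) z
  swapTails {y} {z} A B Cs (split A₁ A₂ eq) = config (B ++ₚ A₂) A₁ Cs , (begin
    edges A ++ edges B ++ cycleEdges Cs
      ≡⟨ cong (_++ edges B ++ cycleEdges Cs) eq ⟩
    (edges A₁ ++ (z , y) ∷ edges A₂) ++ edges B ++ cycleEdges Cs
      ↭⟨ solve 5 (λ a₁ a₂ b c zy → (a₁ ⊕ (zy ⊕ a₂)) ⊕ (b ⊕ c) ⊜ zy ⊕ ((b ⊕ a₂) ⊕ (a₁ ⊕ c)))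
           ↭-refl (edges A₁) (edges A₂) (edges B) (cycleEdges Cs) ((z , y) ∷ []) ⟩
    (z , y) ∷ (edges B ++ edges A₂) ++ edges A₁ ++ cycleEdges Cs
      ≡⟨ cong (λ t → (z , y) ∷ t ++ edges A₁ ++ cycleEdges Cs) (sym (edges-++ B A₂)) ⟩
    (z , y) ∷ edges (B ++ₚ A₂) ++ edges A₁ ++ cycleEdges Cs ∎)

  -- The edge lies on the walk to y: the rest of that walk is a cycle at y.
  closeCycle : (A : Path E v w) (B : Path E v y) (Cs : List Cycle) →
               Split B z y → Retreat (config A B Cs) z
  closeCycle {y} {z} A B Cs (split B₁ B₂ eq) = config A B₁ ((y , B₂) ∷ Cs) , (begin
    edges A ++ edges B ++ cycleEdges Cs
      ≡⟨ cong (λ t → edges A ++ t ++ cycleEdges Cs) eq ⟩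
    edges A ++ (edges B₁ ++ (z , y) ∷ edges B₂) ++ cycleEdges Cs
      ↭⟨ solve 5 (λ a b₁ b₂ c zy → a ⊕ ((b₁ ⊕ (zy ⊕ b₂)) ⊕ c) ⊜ zy ⊕ (a ⊕ (b₁ ⊕ (b₂ ⊕ c))))
           ↭-refl (edges A) (edges B₁) (edges B₂) (cycleEdges Cs) ((z , y) ∷ []) ⟩
    (z , y) ∷ edges A ++ edges B₁ ++ edges B₂ ++ cycleEdges Cs ∎)

  -- The edge lies on a cycle C: the walk to y goes once around C up to z.
  absorbCycle : (A : Path E v w) (B : Path E v y) (Cs : List Cycle) →
                (z , y) ∈ cycleEdges Cs → Retreat (config A B Cs) z
  absorbCycle {y} {z} A B Cs inCs with extractCycle Cs inCs
  ... | (c , C) , Cs′ , inC , perm with splitAt C inC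
  ...   | split C₁ C₂ eq = config A (B ++ₚ (C₂ ++ₚ C₁)) Cs′ , (begin
    edges A ++ edges B ++ cycleEdges Cs
      ↭⟨ ++⁺ˡ (edges A) (++⁺ˡ (edges B) perm) ⟩
    edges A ++ edges B ++ edges C ++ cycleEdges Cs′
      ≡⟨ cong (λ t → edges A ++ edges B ++ t ++ cycleEdges Cs′) eq ⟩
    edges A ++ edges B ++ (edges C₁ ++ (z , y) ∷ edges C₂) ++ cycleEdges Cs′
      ↭⟨ solve 6
           (λ a b c₁ c₂ c zy → a ⊕ (b ⊕ ((c₁ ⊕ (zy ⊕ c₂)) ⊕ c)) ⊜ zy ⊕ (a ⊕ ((b ⊕ (c₂ ⊕ c₁)) ⊕ c)))
           ↭-refl (edges A) (edges B) (edges C₁) (edges C₂) (cycleEdges Cs′) ((z , y) ∷ []) ⟩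
    (z , y) ∷ edges A ++ (edges B ++ edges C₂ ++ edges C₁) ++ cycleEdges Cs′
      ≡⟨ cong (λ t → (z , y) ∷ edges A ++ t ++ cycleEdges Cs′) (sym walkEdges) ⟩
    (z , y) ∷ edges A ++ edges (B ++ₚ (C₂ ++ₚ C₁)) ++ cycleEdges Cs′ ∎)
    where
    walkEdges : edges (B ++ₚ (C₂ ++ₚ C₁)) ≡ edges B ++ edges C₂ ++ edges C₁
    walkEdges rewrite edges-++ B (C₂ ++ₚ C₁) | edges-++ C₂ C₁ = refl

  retreat : (c : Config y) → (z , y) ∈ used c → Retreat c z
  retreat (config A B Cs) m with ∈-++⁻ (edges A) m
  ... | inj₁ inA = swapTails A B Cs (splitAt A inA)
  ... | inj₂ inBCs with ∈-++⁻ (edges B) inBCs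
  ...   | inj₁ inB = closeCycle A B Cs (splitAt B inB)
  ...   | inj₂ inCs = absorbCycle A B Cs inCs

-- Menger's theorem for two edge-disjoint paths, relative to a path P from v to w
module Residual {n : ℕ} (E : Digraph n) {v w : Fin n} (P : Path E v w) where
  open Walks E

  private variable
    a b y z : Fin n

  ResidualEdge : Fin n → Fin n → Set
  ResidualEdge a b = (Edge E a b × (a , b) ∉ edges P) ⊎ (b , a) ∈ edges P

  residualEdge? : ∀ a b → Dec (ResidualEdge a b)
  residualEdge? a b = (edge? a b ×-dec ¬? ((a , b) ∈ₑ? edges P)) ⊎-dec ((b , a) ∈ₑ? edges P)

  Rᴾ : Digraph n
  Rᴾ a b = ⌊ residualEdge? a b ⌋

  toResidual : ResidualEdge a b → Edge Rᴾ a b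
  toResidual r = Equivalence.to T-≡ (fromWitness r)

  fromResidual : Edge Rᴾ a b → ResidualEdge a b
  fromResidual e = toWitness (Equivalence.from T-≡ e)

  module Res = Walks Rᴾ

  -- Without an augmenting walk, the edge of P leaving the set S of residually
  -- reachable vertices is unavoidable: no edge of P enters S, every edge of E
  -- leaving S lies on P, so all walks from v to w leave S by that same edge.
  module NoAugmentingPath (blocked : ¬ Path Rᴾ v w) where
    open Crossing (Res.reachable? v)

    extend : Path Rᴾ v a → Edge Rᴾ a b → Path Rᴾ v b
    extend s r = s Res.++ₚ (r ∷ [ _ ])

    -- The reverse of an edge of P entering S would be a residual edge out of S.
    P-noEntry : ∀ {e} → e ∈ edges P → ¬ Entering e
    P-noEntry m (¬sc , sd) = ¬sc (extend sd (toResidual (inj₂ m)))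

    -- An edge of E off P leaving S would be a residual edge out of S.
    leaving⇒onP : Edge E a b → Leaving (a , b) → (a , b) ∈ edges P
    leaving⇒onP {a} {b} e (sa , ¬sb) with (a , b) ∈ₑ? edges P
    ... | yes onP = onP
    ... | no offP = ⊥-elim (¬sb (extend sa (toResidual (inj₁ (e , offP)))))

    cutEdge : ∃₂ λ a b → Edge E a b × Unavoidable v w a b
    cutEdge with leavingEdge P [ v ] blocked
    ... | (a , b) , m , leaving = a , b , ∈⇒edge P m , λ q →
      let e′ , m′ , leaving′ = leavingEdge q [ v ] blocked
          onP = leaving⇒onP (∈⇒edge q m′) leaving′
      in subst (_∈ edges q) (sym (leaving-unique P P-noEntry m leaving onP leaving′)) m′

  -- Along an augmenting walk the configuration evolves from (P , [ v ] , [])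
  -- to two edge-disjoint walks to w.  With `ahead` the vertices the walk has
  -- still to depart from, the invariant says: every edge is used at most once,
  -- used edges off P start behind, and edges of P ending ahead are still used.
  module AugmentingPath (P-unique : Unique (edges P)) where
    open Configurations E v w

    record Invariant (ahead : List (Fin n)) (c : Config y) : Set where
      field
        once : Unique (used c)
        offP-behind : ∀ {e} → e ∈ used c → e ∉ edges P → proj₁ e ∉ ahead
        onP-ahead : ∀ {e} → e ∈ edges P → proj₂ e ∈ ahead → e ∈ used c
    open Invariant

    Stage : Fin n → List (Fin n) → Set
    Stage y ahead = Σ (Config y) (Invariant ahead)

    start : ∀ ahead → Stage v ahead
    start ahead = config P [ v ] [] , record
      { once = subst Unique (sym (++-identityʳ (edges P))) P-unique
      ; offP-behind = λ m offP → ⊥-elim (offP (onlyP m))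
      ; onP-ahead = λ m _ → ∈-++⁺ˡ m
      }
      where
      onlyP : ∀ {e} → e ∈ edges P ++ [] → e ∈ edges P
      onlyP m = subst (_ ∈_) (++-identityʳ (edges P)) m

    -- A forward residual edge (y , z) off P is unused, since y is still ahead.
    forwardStep : ∀ {ahead} → y ∉ ahead → Stage y (y ∷ ahead) →
                  Edge E y z → (y , z) ∉ edges P → Stage z ahead
    forwardStep {y} {ahead = ahead} y∉ (c , inv) e offP with advance c e
    ... | c′ , perm = c′ , record
      { once = unique-resp-↭ (↭-sym perm) (unique-∷ unused (once inv))
      ; offP-behind = offP-behind′
      ; onP-ahead = λ m d → ∈-resp-↭ (↭-sym perm) (there (onP-ahead inv m (there d)))
      }
      where
      unused : (y , _) ∉ used c
      unused m = offP-behind inv m offP (here refl)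
      offP-behind′ : ∀ {e} → e ∈ used c′ → e ∉ edges P → proj₁ e ∉ ahead
      offP-behind′ m offP′ with ∈-resp-↭ perm m
      ... | here refl = y∉
      ... | there k = λ d → offP-behind inv k offP′ (there d)

    -- A backward residual edge reverses an edge (z , y) of P, still used as y is ahead.
    backwardStep : ∀ {ahead} → y ∉ ahead → Stage y (y ∷ ahead) →
                   (z , y) ∈ edges P → Stage z ahead
    backwardStep {ahead = ahead} y∉ (c , inv) onP with retreat c (onP-ahead inv onP (here refl))
    ... | c′ , perm = c′ , record
      { once = tail (unique-resp-↭ perm (once inv))
      ; offP-behind = λ m offP d → offP-behind inv (∈-resp-↭ (↭-sym perm) (there m)) offP (there d)
      ; onP-ahead = onP-ahead′
      }
      where
      tail : ∀ {e es} → Unique (e ∷ es) → Unique es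
      tail (_ ∷ u) = u
      onP-ahead′ : ∀ {e} → e ∈ edges P → proj₂ e ∈ ahead → e ∈ used c′
      onP-ahead′ m d with ∈-resp-↭ perm (onP-ahead inv m (there d))
      ... | here refl = ⊥-elim (y∉ d)
      ... | there k = k

    follow : (Q : Path Rᴾ y w) → Unique (Res.sources Q) → Stage y (Res.sources Q) →
             TwoEdgeDisjointPaths E v w
    follow [ _ ] _ (config A B _ , inv) = A , B , λ _ _ onA onB →
      unique-++-disjoint (edges A) (once inv) (edgeOn⇒∈ onA) (∈-++⁺ˡ (edgeOn⇒∈ onB))
    follow (r ∷ Q) u@(_ ∷ uQ) stage with fromResidual r
    ... | inj₁ (e , offP) = follow Q uQ (forwardStep (Unique[x∷xs]⇒x∉xs u) stage e offP)
    ... | inj₂ onP = follow Q uQ (backwardStep (Unique[x∷xs]⇒x∉xs u) stage onP)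

    -- An augmenting walk can be taken simple, so that it departs from each vertex once.
    augment : Path Rᴾ v w → TwoEdgeDisjointPaths E v w
    augment Q with Res.simplify Q
    ... | Q′ , simple = follow Q′ simple (start (Res.sources Q′))

  twoPaths-or-cutEdge : Unique (edges P) →
                        TwoEdgeDisjointPaths E v w ⊎ ∃₂ λ a b → Edge E a b × Unavoidable v w a b
  twoPaths-or-cutEdge P-unique with Res.reachable? v w
  ... | yes Q = inj₁ (AugmentingPath.augment P-unique Q)
  ... | no blocked = inj₂ (NoAugmentingPath.cutEdge blocked)

lemma3 : (n : ℕ) (E : Digraph n) → StronglyConnected E →
         (v w : Fin n) → w ≢ v →
         TwoEdgeDisjointPaths E v w ⇔
           (¬ (∃[ x ] (Marked E v x × Dominates E v x w)))
lemma3 n E sc v w _ = mk⇔ noMarkedDominator twoPaths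
  where
  open Walks E
  open Unavoidability E

  noMarkedDominator : TwoEdgeDisjointPaths E v w → ¬ (∃[ x ] (Marked E v x × Dominates E v x w))
  noMarkedDominator paths (_ , marked , dom) =
    let _ , H = marked⇒unavoidable marked dom in disjoint⇒avoidable paths H

  twoPaths : ¬ (∃[ x ] (Marked E v x × Dominates E v x w)) → TwoEdgeDisjointPaths E v w
  twoPaths noMarked with simplify (sc v w)
  ... | P , simple with Residual.twoPaths-or-cutEdge E P (simple⇒edges-unique P simple)
  ...   | inj₁ paths = paths
  ...   | inj₂ (_ , b , e , H) = ⊥-elim (noMarked (b , unavoidable⇒marked e P H))
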